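{- Let $\Phi$ be a CNF formula on variables $x_1,\dots,x_n$ and $x$ a variable such that $\Phi$ has satisfying assignments with $x=T$ and with $x=F$. Run the coupling procedure described in the context on $\Phi$ and $x$ (with any fixed marking of variables and any fixed rule for choosing clauses), and consider its state at termination. Let $\mathcal{C}_O$ be the set of remaining (non-deleted) clauses all of whose variables lie in $V_O$, and $\Phi'_O = \bigwedge_{c\in\mathcal{C}_O} c$. Then the simplification of $\Phi'_O$ with respect to $\mathcal{A}_1$ equals the simplification of $\Phi'_O$ with respect to $\mathcal{A}_2$.
   Context: Simplification of a formula with respect to a partial assignment: delete every clause containing a literal made true by the assignment, and remove every literal made false. Coupling procedure: the variables of $\Phi$ are labeled marked/unmarked by a fixed labeling. The procedure maintains two partial assignments $\mathcal{A}_1,\mathcal{A}_2$ (always setting the same set of variables), a partition $V_I\cup V_O$ of the variables, and a set of remaining clauses (initially all clauses). For $i=1,2$, $\mathcal{D}_i$ denotes the uniform distribution on satisfying assignments of $\Phi$ consistent with the current $\mathcal{A}_i$. Initially $\mathcal{A}_1(x)=T$, $\mathcal{A}_2(x)=F$, $V_I=\{x\}$, $V_O$ = all other variables. While there is a remaining clause $c$ with a variable in $V_I$ and a variable in $V_O$ (chosen by a fixed deterministic rule): its unset marked variables are set one at a time; to set $y$, let $p_i=\Pr_{\mathcal{D}_i}[y=T]$ and choose $(\mathcal{A}_1(y),\mathcal{A}_2(y))$ to be $(T,T)$ with probability $\min(p_1,p_2)$, $(F,F)$ with probability $\min(1-p_1,1-p_2)$, and otherwise $(T,F)$ if $p_1>p_2$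 or $(F,T)$ if $p_1\le p_2$. Then: Case 1, if $c$ is satisfied by the variables already set in $\mathcal{A}_1$ and also in $\mathcal{A}_2$, let $S$ be the variables of $c$ with different values in $\mathcal{A}_1$ and $\mathcal{A}_2$, set $V_I\leftarrow V_I\cup S$, $V_O\leftarrow V_O\setminus S$, and delete $c$; Case 2, otherwise, let $S$ be all variables of $c$ (marked or unmarked) and set $V_I\leftarrow V_I\cup S$, $V_O\leftarrow V_O\setminus S$. The procedure ends when no such clause exists. -}

module Defs where

open import Data.Bool using (Bool; true; false; not; _∧_; _∨_; if_then_else_)
open import Data.Nat using (ℕ; zero; suc; _*_; _<_)
open import Data.Fin using (Fin) renaming (_≟_ to _≟F_)
open import Data.Maybe using (Maybe; just; nothing; is-nothing)
open import Data.List using (List; []; _∷_; map; filterᵇ; allFin; concatMap; length)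
open import Data.Bool.ListAction using (any; all)
open import Data.Vec.Functional using () renaming (_∷_ to _∷ᶠ_)
open import Relation.Nullary.Decidable using (⌊_⌋)
open import Relation.Binary.PropositionalEquality using (_≡_)
open import Data.Product using (_×_)

record Literal (n : ℕ) : Set where
  constructor lit
  field
    var  : Fin n
    sign : Bool     -- true = positive literal x, false = negated literal ¬x
open Literal public

Clause : ℕ → Set
Clause n = List (Literal n)

Formula : ℕ → ℕ → Set
Formula n m = Fin m → Clause n

CNF : ℕ → Set
CNF n = List (Clause n)

Assignment : ℕ → Set
Assignment n = Fin n → Bool

PartialAssignment : ℕ → Set
PartialAssignment n = Fin n → Maybe Bool

litVal : ∀ {n} → Literal n → Bool → Bool
litVal l b = if sign l then b else not b

satClause : ∀ {n} → Assignment n → Clause n → Bool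
satClause σ c = any (λ l → litVal l (σ (var l))) c

satFormula : ∀ {n m} → Assignment n → Formula n m → Bool
satFormula {m = m} σ Φ = all (λ i → satClause σ (Φ i)) (allFin m)

agreesᵇ : Maybe Bool → Bool → Bool
agreesᵇ nothing  b = true
agreesᵇ (just a) b = if a then b else not b

consistent : ∀ {n} → PartialAssignment n → Assignment n → Bool
consistent {n} A σ = all (λ v → agreesᵇ (A v) (σ v)) (allFin n)

allAssignments : (n : ℕ) → List (Assignment n)
allAssignments zero    = (λ ()) ∷ []
allAssignments (suc n) = concatMap (λ f → (true ∷ᶠ f) ∷ (false ∷ᶠ f) ∷ []) (allAssignments n)

#sat : ∀ {n m} → Formula n m → PartialAssignment n → ℕ
#sat {n} Φ A = length (filterᵇ (λ σ → satFormula σ Φ ∧ consistent A σ) (allAssignments n))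

#satT : ∀ {n m} → Formula n m → PartialAssignment n → Fin n → ℕ
#satT {n} Φ A y = length (filterᵇ (λ σ → satFormula σ Φ ∧ consistent A σ ∧ σ y) (allAssignments n))

update : ∀ {n} → PartialAssignment n → Fin n → Bool → PartialAssignment n
update A y b v = if ⌊ v ≟F y ⌋ then just b else A v

litTrue : ∀ {n} → PartialAssignment n → Literal n → Bool
litTrue A l with A (var l)
... | nothing = false
... | just b  = litVal l b

litFalse : ∀ {n} → PartialAssignment n → Literal n → Bool
litFalse A l with A (var l)
... | nothing = false
... | just b  = not (litVal l b)

satisfiedBy : ∀ {n} → PartialAssignment n → Clause n → Bool
satisfiedBy A c = any (litTrue A) c

simplify : ∀ {n} → CNF n → PartialAssignment n → CNF n
simplify F A = map (filterᵇ (λ l → not (litFalse A l))) (filterᵇ (λ c → not (satisfiedBy A c)) F)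

record State (n m : ℕ) : Set where
  constructor st
  field
    A₁ A₂ : PartialAssignment n
    VI    : Fin n → Bool        -- true: in V_I, false: in V_O
    rem   : Fin m → Bool        -- true: clause not yet deleted
open State public

initState : ∀ {n m} → Fin n → State n m
initState x = st (λ v → if ⌊ v ≟F x ⌋ then just true else nothing)
                 (λ v → if ⌊ v ≟F x ⌋ then just false else nothing)
                 (λ v → ⌊ v ≟F x ⌋)
                 (λ _ → true)

eligible : ∀ {n m} → Formula n m → State n m → Fin m → Bool
eligible Φ s c = rem s c ∧ any (λ l → VI s (var l)) (Φ c) ∧ any (λ l → not (VI s (var l))) (Φ c)

ValidRule : ∀ {n m} → Formula n m → (State n m → Maybe (Fin m)) → Set
ValidRule {n} {m} Φ rule =
  ∀ (s : State n m) →
    ((rule s ≡ nothing) → ∀ c → eligible Φ s c ≡ false) ×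
    (∀ c → rule s ≡ just c → eligible Φ s c ≡ true)

-- joint values (A₁(y), A₂(y)) that receive positive probability in the
-- coupling step, with p_i = #satT Φ A_i y / #sat Φ A_i
data Allowed {n m} (Φ : Formula n m) (A₁ A₂ : PartialAssignment n) (y : Fin n) : Bool → Bool → Set where
  TT : 0 < #satT Φ A₁ y → 0 < #satT Φ A₂ y → Allowed Φ A₁ A₂ y true true
  FF : #satT Φ A₁ y < #sat Φ A₁ → #satT Φ A₂ y < #sat Φ A₂ → Allowed Φ A₁ A₂ y false false
  TF : #satT Φ A₂ y * #sat Φ A₁ < #satT Φ A₁ y * #sat Φ A₂ → Allowed Φ A₁ A₂ y true false   -- p₁ > p₂
  FT : #satT Φ A₁ y * #sat Φ A₂ < #satT Φ A₂ y * #sat Φ A₁ → Allowed Φ A₁ A₂ y false true   -- p₂ > p₁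

data SetVars {n m} (Φ : Formula n m) (marked : Fin n → Bool) :
     Clause n → PartialAssignment n → PartialAssignment n →
     PartialAssignment n → PartialAssignment n → Set where
  done : ∀ {A₁ A₂} → SetVars Φ marked [] A₁ A₂ A₁ A₂
  skip : ∀ {l ls A₁ A₂ B₁ B₂} →
         (marked (var l) ∧ is-nothing (A₁ (var l))) ≡ false →
         SetVars Φ marked ls A₁ A₂ B₁ B₂ →
         SetVars Φ marked (l ∷ ls) A₁ A₂ B₁ B₂
  set  : ∀ {l ls A₁ A₂ B₁ B₂ b₁ b₂} →
         (marked (var l) ∧ is-nothing (A₁ (var l))) ≡ true →
         Allowed Φ A₁ A₂ (var l) b₁ b₂ →
         SetVars Φ marked ls (update A₁ (var l) b₁) (update A₂ (var l) b₂) B₁ B₂ →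
         SetVars Φ marked (l ∷ ls) A₁ A₂ B₁ B₂

differ : Maybe Bool → Maybe Bool → Bool
differ nothing  nothing  = false
differ (just true)  (just true)  = false
differ (just false) (just false) = false
differ _        _        = true

-- Case 1 / Case 2 after the variables of clause c have been set
finish : ∀ {n m} → Formula n m → State n m → Fin m →
         PartialAssignment n → PartialAssignment n → State n m
finish Φ s c B₁ B₂ =
  if satisfiedBy B₁ (Φ c) ∧ satisfiedBy B₂ (Φ c)
  then st B₁ B₂
          (λ v → VI s v ∨ any (λ l → ⌊ var l ≟F v ⌋ ∧ differ (B₁ v) (B₂ v)) (Φ c))
          (λ d → rem s d ∧ not ⌊ d ≟F c ⌋)
  else st B₁ B₂
          (λ v → VI s v ∨ any (λ l → ⌊ var l ≟F v ⌋) (Φ c))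
          (rem s)

data Step {n m} (Φ : Formula n m) (marked : Fin n → Bool)
          (rule : State n m → Maybe (Fin m)) : State n m → State n m → Set where
  step : ∀ {s c B₁ B₂} → rule s ≡ just c →
         SetVars Φ marked (Φ c) (A₁ s) (A₂ s) B₁ B₂ →
         Step Φ marked rule s (finish Φ s c B₁ B₂)

-- states reachable (with positive probability) from the initial state
data Reachable {n m} (Φ : Formula n m) (marked : Fin n → Bool)
               (rule : State n m → Maybe (Fin m)) (x : Fin n) : State n m → Set where
  start : Reachable Φ marked rule x (initState x)
  next  : ∀ {s s'} → Reachable Φ marked rule x s → Step Φ marked rule s s' →
          Reachable Φ marked rule x s'

Terminated : ∀ {n m} → Formula n m → State n m → Set
Terminated {m = m} Φ s = ∀ (c : Fin m) → eligible Φ s c ≡ false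

PhiO : ∀ {n m} → Formula n m → State n m → CNF n
PhiO {m = m} Φ s =
  map Φ (filterᵇ (λ c → rem s c ∧ all (λ l → not (VI s (var l))) (Φ c)) (allFin m))

-- Every variable on which A₁ and A₂ come to differ is moved into V_I at once:
-- in Case 1 it belongs to S, in Case 2 the whole clause does, and SetVars
-- touches only variables of the chosen clause. Hence A₁ and A₂ agree on V_O
-- at every reachable state, and the clauses of Φ'_O mention only V_O
-- variables, whose values are all that simplification inspects.
module Submission where

open import Defs
open import Data.Nat using (ℕ)
open import Data.Fin using (Fin) renaming (_≟_ to _≟F_)
open import Data.Bool using (Bool; true; false; T; not; _∧_; _∨_)
open import Data.Bool.Properties using (∧-identityʳ; T-∧; T-not-≡)
open import Data.Maybe using (Maybe; just; nothing)
open import Data.List using (_∷_; map; filterᵇ; allFin)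
open import Data.List.Properties using (map-cong; map-cong-local)
open import Data.List.Relation.Unary.All as All using (All; []; _∷_)
open import Data.List.Relation.Unary.All.Properties using (map⁺; all-filter; filter⁺; all⁺)
open import Data.Bool.ListAction using (or; any; all)
open import Data.Product using (∃; _×_; _,_; proj₂)
open import Function using (_∘_; Equivalence)
open import Relation.Nullary using (yes; no; contradiction)
open import Relation.Nullary.Decidable using (⌊_⌋; T?)
open import Relation.Binary.PropositionalEquality
  using (_≡_; _≢_; refl; sym; trans; cong; cong₂; module ≡-Reasoning)

private
  variable
    n m : ℕ

∨-conical : ∀ x {y} → x ∨ y ≡ false → x ≡ false × y ≡ false
∨-conical false y≡false = refl , y≡false

any-cong-local : ∀ {A : Set} {p q : A → Bool} {xs} →
                 All (λ x → p x ≡ q x) xs → any p xs ≡ any q xs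
any-cong-local []           = refl
any-cong-local (px≡qx ∷ eqs) = cong₂ _∨_ px≡qx (any-cong-local eqs)

filterᵇ-cong-local : ∀ {A : Set} {p q : A → Bool} {xs} →
                     All (λ x → p x ≡ q x) xs → filterᵇ p xs ≡ filterᵇ q xs
filterᵇ-cong-local []                                          = refl
filterᵇ-cong-local {q = q} {xs = x ∷ _} (px≡qx ∷ eqs) rewrite px≡qx with q x
... | true  = cong (x ∷_) (filterᵇ-cong-local eqs)
... | false = filterᵇ-cong-local eqs

AgreeAt : PartialAssignment n → PartialAssignment n → Literal n → Set
AgreeAt A₁ A₂ l = A₁ (var l) ≡ A₂ (var l)

module _ {A₁ A₂ : PartialAssignment n} where

  litTrue-cong : ∀ {l} → AgreeAt A₁ A₂ l → litTrue A₁ l ≡ litTrue A₂ l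
  litTrue-cong {l} eq with A₁ (var l) | A₂ (var l) | eq
  ... | a | .a | refl = refl

  litFalse-cong : ∀ {l} → AgreeAt A₁ A₂ l → litFalse A₁ l ≡ litFalse A₂ l
  litFalse-cong {l} eq with A₁ (var l) | A₂ (var l) | eq
  ... | a | .a | refl = refl

  satisfiedBy-cong : ∀ {c} → All (AgreeAt A₁ A₂) c → satisfiedBy A₁ c ≡ satisfiedBy A₂ c
  satisfiedBy-cong agree = any-cong-local (All.map litTrue-cong agree)

  simplify-cong : ∀ {F} → All (All (AgreeAt A₁ A₂)) F → simplify F A₁ ≡ simplify F A₂
  simplify-cong {F} agree = begin
    map (prune A₁) (filterᵇ (unsat A₁) F) ≡⟨ cong (map (prune A₁)) (filterᵇ-cong-local
                                                (All.map (cong not ∘ satisfiedBy-cong) agree)) ⟩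
    map (prune A₁) (filterᵇ (unsat A₂) F) ≡⟨ map-cong-local (All.map prune-cong
                                                (filter⁺ (T? ∘ unsat A₂) agree)) ⟩
    map (prune A₂) (filterᵇ (unsat A₂) F) ∎
    where
    open ≡-Reasoning
    unsat : PartialAssignment n → Clause n → Bool
    unsat A c = not (satisfiedBy A c)
    prune : PartialAssignment n → Clause n → Clause n
    prune A = filterᵇ (λ l → not (litFalse A l))
    prune-cong : ∀ {c} → All (AgreeAt A₁ A₂) c → prune A₁ c ≡ prune A₂ c
    prune-cong agree = filterᵇ-cong-local (All.map (cong not ∘ litFalse-cong) agree)

AgreeOnVO : State n m → Set
AgreeOnVO s = ∀ v → VI s v ≡ false → A₁ s v ≡ A₂ s v

occurs : Fin n → Clause n → Bool
occurs v c = any (λ l → ⌊ var l ≟F v ⌋) c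

update-other : ∀ (A : PartialAssignment n) {y v b} → y ≢ v → update A y b v ≡ A v
update-other _ {y} {v} y≢v with v ≟F y
... | yes v≡y = contradiction (sym v≡y) y≢v
... | no  _   = refl

setVars-untouched : ∀ {Φ : Formula n m} {marked cl A₁ A₂ B₁ B₂ v} →
                    SetVars Φ marked cl A₁ A₂ B₁ B₂ → occurs v cl ≡ false →
                    B₁ v ≡ A₁ v × B₂ v ≡ A₂ v
setVars-untouched done _ = refl , refl
setVars-untouched {cl = l ∷ _} {v = v} (skip _ sv) v∉c with var l ≟F v
... | no _ = setVars-untouched sv v∉c
setVars-untouched (skip _ _) () | yes _
setVars-untouched {cl = l ∷ _} {A₁} {A₂} {v = v} (set _ _ sv) v∉c with var l ≟F v
... | no l≢v = let B₁v , B₂v = setVars-untouched sv v∉c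
               in trans B₁v (update-other A₁ l≢v) , trans B₂v (update-other A₂ l≢v)
setVars-untouched (set _ _ _) () | yes _

differ≡false⇒≡ : ∀ {a b} → differ a b ≡ false → a ≡ b
differ≡false⇒≡ {nothing}    {nothing}    _ = refl
differ≡false⇒≡ {just true}  {just true}  _ = refl
differ≡false⇒≡ {just false} {just false} _ = refl
differ≡false⇒≡ {nothing}    {just _}     ()
differ≡false⇒≡ {just true}  {nothing}    ()
differ≡false⇒≡ {just true}  {just false} ()
differ≡false⇒≡ {just false} {nothing}    ()
differ≡false⇒≡ {just false} {just true}  ()

setVars-agree : ∀ {Φ : Formula n m} {s : State n m} {marked cl B₁ B₂ v} → AgreeOnVO s →
                SetVars Φ marked cl (A₁ s) (A₂ s) B₁ B₂ →
                VI s v ≡ false → occurs v cl ≡ false → B₁ v ≡ B₂ v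
setVars-agree {v = v} agree sv v∈VO v∉c =
  let B₁v , B₂v = setVars-untouched sv v∉c in trans B₁v (trans (agree v v∈VO) (sym B₂v))

step-agree : ∀ {Φ : Formula n m} {marked rule s s'} →
             AgreeOnVO s → Step Φ marked rule s s' → AgreeOnVO s'
step-agree {Φ = Φ} {s = s} agree (step {c = c} {B₁} {B₂} _ sv) v v∈VO′
  with satisfiedBy B₁ (Φ c) ∧ satisfiedBy B₂ (Φ c)
... | false = let v∈VO , v∉c = ∨-conical (VI s v) v∈VO′ in setVars-agree {s = s} agree sv v∈VO v∉c
... | true with differ (B₁ v) (B₂ v) in B₁v≠B₂v
...   | false = differ≡false⇒≡ B₁v≠B₂v
...   | true  = let v∈VO , v∉S = ∨-conical (VI s v) v∈VO′
                in setVars-agree {s = s} agree sv v∈VO (trans (sym S≡occurrences) v∉S)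
  where
  S≡occurrences : any (λ l → ⌊ var l ≟F v ⌋ ∧ true) (Φ c) ≡ occurs v (Φ c)
  S≡occurrences = cong or (map-cong (∧-identityʳ ∘ λ l → ⌊ var l ≟F v ⌋) (Φ c))

reachable-agree : ∀ {Φ : Formula n m} {marked rule x s} →
                  Reachable Φ marked rule x s → AgreeOnVO s
reachable-agree {x = x} start v v∈VO with v ≟F x
... | no _ = refl
reachable-agree start v () | yes _
reachable-agree (next r s→s′) = step-agree (reachable-agree r) s→s′

PhiO-agree : ∀ (Φ : Formula n m) (s : State n m) →
             AgreeOnVO s → All (All (AgreeAt (A₁ s) (A₂ s))) (PhiO Φ s)
PhiO-agree {m = m} Φ s agree = map⁺ (All.map inVO⇒agree (all-filter (T? ∘ remainsInVO) (allFin m)))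
  where
  remainsInVO : Fin m → Bool
  remainsInVO c = rem s c ∧ all (λ l → not (VI s (var l))) (Φ c)
  inVO⇒agree : ∀ {c} → T (remainsInVO c) → All (AgreeAt (A₁ s) (A₂ s)) (Φ c)
  inVO⇒agree {c} t = All.map (λ {l} l∈VO → agree (var l) (Equivalence.to T-not-≡ l∈VO))
                             (all⁺ _ (Φ c) (proj₂ (Equivalence.to T-∧ t)))

corollary3p5 : ∀ {n m : ℕ} (Φ : Formula n m) (x : Fin n)
                 (marked : Fin n → Bool) (rule : State n m → Maybe (Fin m)) →
                 ValidRule Φ rule →
                 (∃ λ (σ : Assignment n) → satFormula σ Φ ≡ true × σ x ≡ true) →
                 (∃ λ (σ : Assignment n) → satFormula σ Φ ≡ true × σ x ≡ false) →
                 ∀ (s : State n m) → Reachable Φ marked rule x s → Terminated Φ s →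
                 simplify (PhiO Φ s) (A₁ s) ≡ simplify (PhiO Φ s) (A₂ s)
corollary3p5 Φ _ _ _ _ _ _ s reachable _ = simplify-cong (PhiO-agree Φ s (reachable-agree reachable))
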